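{- Let $\lambda$ be a partition with $\lambda_1\le m$. For $1\le j\le m$ let $\lambda^{c}_j$ be the partition obtained from $\lambda$ by removing its $j$th column (so $\lambda^{c}_j=\lambda$ if $j>\lambda_1$). Then for every integer $i\ge 0$, \[ \sum_{j=1}^m q^{m-j}R_i(\lambda^{c}_j)=R_i(\lambda)\,[m-i]-R_{i+1}(\lambda)\,(q^m-q^{m-i-1}). \]
   Context: $q$ is an indeterminate and $[x]=(1-q^x)/(1-q)$ for integers $x$. A partition $\lambda$ is identified with its Ferrers board of cells $(i,j)$, $1\le j\le\lambda_i$, rows numbered from the top and columns from the left. The Garsia–Remmel $q$-rook number $R_k(\lambda)=\sum_p q^{\mathrm{inv}(p)}$, summed over placements $p$ of $k$ non-attacking rooks (no two in a row or column) on cells of $\lambda$, where $\mathrm{inv}(p)$ is the number of cells of $\lambda$ that contain no rook, are not to the left of a rook in the same row, and are not above a rook in the same column. -}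

module Defs where

open import Data.Nat using (ℕ; zero; suc; _≤_; _≥_; _∸_; _+_; _≡ᵇ_; _<ᵇ_; _≤ᵇ_)
open import Data.Bool using (Bool; true; false; not; _∧_; if_then_else_)
open import Data.Maybe using (Maybe; nothing; just)
open import Data.List using (List; []; _∷_; [_]; map; concatMap; catMaybes; upTo; filterᵇ; length; foldr)
open import Data.Bool.ListAction using (any)
open import Data.Nat.ListAction using (sum)
open import Data.List.Relation.Unary.Linked using (Linked)
open import Data.List.Relation.Unary.All using (All)
open import Data.Product using (_×_)
open import Algebra.Bundles using (CommutativeRing)

-- Its Ferrers board has cells
-- (r , c) with row r (0-indexed from the top) and column c < λ_r
-- (0-indexed from the left).

IsPartition : List ℕ → Set
IsPartition la = Linked _≥_ la × All (1 ≤_) la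

largestPart : List ℕ → ℕ
largestPart []      = 0
largestPart (x ∷ _) = x

-- λ^c_j : remove the j-th column (j 1-indexed).  Rows of length ≥ j lose
-- one cell; rows that become empty are dropped.  If j > λ₁ nothing changes.
removeColumn : ℕ → List ℕ → List ℕ
removeColumn j la =
  filterᵇ (λ r → 1 ≤ᵇ r) (map (λ r → if j ≤ᵇ r then r ∸ 1 else r) la)

-- A placement on λ is a list with one entry per row:
-- nothing (no rook in that row) or just c (a rook in column c < λ_r).
-- Rooks in distinct rows never attack along rows; non-attacking then
-- means the occupied columns are pairwise distinct.

rowChoices : ℕ → List (Maybe ℕ)
rowChoices r = nothing ∷ map just (upTo r)

allRowAssignments : List ℕ → List (List (Maybe ℕ))
allRowAssignments []       = [ [] ]
allRowAssignments (r ∷ la) =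
  concatMap (λ x → map (x ∷_) (allRowAssignments la)) (rowChoices r)

distinct : List ℕ → Bool
distinct []       = true
distinct (x ∷ xs) = not (any (x ≡ᵇ_) xs) ∧ distinct xs

rookPlacements : ℕ → List ℕ → List (List (Maybe ℕ))
rookPlacements k la =
  filterᵇ (λ p → (length (catMaybes p) ≡ᵇ k) ∧ distinct (catMaybes p))
          (allRowAssignments la)

freeInRow : Maybe ℕ → ℕ → Bool
freeInRow nothing   c = true
freeInRow (just c') c = c' <ᵇ c

-- inv(p): number of cells with no rook, not to the left of a rook in the
-- same row, and not above a rook in the same column (the rows below the
-- current row are the tail of the list).
inv : List ℕ → List (Maybe ℕ) → ℕ
inv []       _        = 0
inv (_ ∷ _)  []       = 0
inv (r ∷ la) (x ∷ p)  =
  sum (map (λ c → if freeInRow x c ∧ not (any (c ≡ᵇ_) (catMaybes p)) then 1 else 0)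
           (upTo r))
  + inv la p

-- q-analogues, evaluated at an arbitrary element q of an arbitrary
-- commutative ring (a polynomial identity in ℤ[q] is the same as an
-- identity holding for every q in every commutative ring).

module _ {c ℓ} (R : CommutativeRing c ℓ) where
  open CommutativeRing R hiding (_+_)
  open CommutativeRing R using () renaming (_+_ to _+R_)

  pow : Carrier → ℕ → Carrier
  pow q zero    = 1#
  pow q (suc n) = q * pow q n

  ringSum : List Carrier → Carrier
  ringSum = foldr _+R_ 0#

  qInt : Carrier → ℕ → Carrier
  qInt q n = ringSum (map (pow q) (upTo n))

  qRook : Carrier → ℕ → List ℕ → Carrier
  qRook q k la = ringSum (map (λ p → pow q (inv la p)) (rookPlacements k la))

-- Deleting the top row of length r from a board whose lower rows t hold k rooks (necessarily in
-- k of the first r columns) gives the row recurrence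
--   R_0(r ∷ t) = q^r R_0(t),   R_{k+1}(r ∷ t) = q^(r-k-1) R_{k+1}(t) + [r-k] R_k(t):
-- an empty top row has r - k uncovered cells, and a rook in the top row sits in one of the r - k free
-- columns, contributing q^(number of free columns to its right).  The identity is then proved for this
-- recurrence by induction on the board.  It is trivial for m = 0, and passes from m to m + 1 once
-- λ₁ ≤ m, since removing column m + 1 changes nothing.  For λ = r ∷ t and m = r every removal of a
-- column j ≤ r shortens the top row to r - 1, so the recurrence expresses the left side at i as
-- q^(r-1-i) times the left side for t at i plus [r-i] times the left side for t at i - 1, and the
-- identity for λ is that same linear combination of the identities for t.

module Submission where

open import Defs
open import Algebra.Bundles using (CommutativeRing)
import Algebra.Properties.AbelianGroup as AbelianGroupProperties
import Algebra.Properties.CommutativeSemigroup as CommutativeSemigroupProperties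
import Algebra.Properties.Group as GroupProperties
import Algebra.Properties.Ring as RingProperties
open import Data.Bool using (Bool; true; false; T; not; _∧_; _∨_; if_then_else_)
open import Data.Bool.ListAction using (any)
open import Data.Bool.Properties using (T-∧)
open import Data.Empty using (⊥-elim)
open import Data.List
  using (List; []; _∷_; _++_; _∷ʳ_; map; upTo; applyUpTo; catMaybes; concatMap; filterᵇ; length)
open import Data.List.Properties
  using (map-cong; map-cong-local; map-∘; map-++; map-applyUpTo; map-upTo; map-id-local; length-upTo; upTo-∷ʳ)
open import Data.List.Relation.Unary.All as All using (All; []; _∷_)
open import Data.List.Relation.Unary.All.Properties using (all-upTo; concat⁺; map⁺)
open import Data.List.Relation.Unary.AllPairs as AllPairs using (AllPairs; []; _∷_)
import Data.List.Relation.Unary.AllPairs.Properties as AllPairsₚ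
open import Data.List.Relation.Unary.Linked.Properties using (Linked⇒AllPairs)
open import Data.Maybe using (Maybe; nothing; just)
open import Data.Nat as ℕ
  using (ℕ; zero; suc; _∸_; _≤_; _<_; _≥_; _≤′_; ≤′-reflexive; ≤′-step; z≤n; s≤s; _≤?_; _≤ᵇ_; _<ᵇ_; _≡ᵇ_)
open import Data.Nat.ListAction using (sum)
open import Data.Nat.Properties as ℕₚ
  using (≤-refl; ≤-trans; <⇒≤; <-≤-trans; <-irrefl; <⇒≱; ≰⇒>; ≤⇒≤′; ≤′⇒≤; ≤ᵇ⇒≤; ≤⇒≤ᵇ; <ᵇ⇒<; <⇒<ᵇ;
         ≡ᵇ⇒≡; ∸-monoˡ-≤; 0∸n≡0; n∸n≡0; m≤n⇒m∸n≡0; m≤n⇒m≤1+n; m+n∸n≡m; +-∸-assoc)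
open import Data.Product using (_,_; proj₁; proj₂)
open import Function using (_∘_; Equivalence)
open import Relation.Binary.PropositionalEquality as ≡ using (_≡_)
open import Relation.Nullary using (¬_; yes; no)

if-T : ∀ {A : Set} {b} {x y : A} → T b → (if b then x else y) ≡ x
if-T {b = true} _ = ≡.refl

if-¬T : ∀ {A : Set} {b} {x y : A} → ¬ T b → (if b then x else y) ≡ y
if-¬T {b = true}  ¬t = ⊥-elim (¬t _)
if-¬T {b = false} _  = ≡.refl

∧-T : ∀ {a} b → T a → (a ∧ b) ≡ b
∧-T {true} b _ = ≡.refl

∧-¬T : ∀ {a} b → ¬ T a → (a ∧ b) ≡ false
∧-¬T {true}  b ¬t = ⊥-elim (¬t _)
∧-¬T {false} b _  = ≡.refl

indicator : Bool → ℕ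
indicator b = if b then 1 else 0

sum-map-const : ∀ {A : Set} k (xs : List A) → sum (map (λ _ → k) xs) ≡ length xs ℕ.* k
sum-map-const k []       = ≡.refl
sum-map-const k (x ∷ xs) = ≡.cong (k ℕ.+_) (sum-map-const k xs)

sum-map-+ : ∀ {A : Set} (f g : A → ℕ) xs →
            sum (map (λ x → f x ℕ.+ g x) xs) ≡ sum (map f xs) ℕ.+ sum (map g xs)
sum-map-+ f g []       = ≡.refl
sum-map-+ f g (x ∷ xs) =
  ≡.trans (≡.cong (f x ℕ.+ g x ℕ.+_) (sum-map-+ f g xs)) (ℕ+.interchange (f x) (g x) _ _)
  where module ℕ+ = CommutativeSemigroupProperties ℕₚ.+-commutativeSemigroup

m∸n∸1≡m∸[1+n] : ∀ m k → m ∸ k ∸ 1 ≡ m ∸ suc k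
m∸n∸1≡m∸[1+n] m       zero    = ≡.refl
m∸n∸1≡m∸[1+n] zero    (suc k) = ≡.refl
m∸n∸1≡m∸[1+n] (suc m) (suc k) = m∸n∸1≡m∸[1+n] m k

removeColumnFromRow : ℕ → ℕ → ℕ
removeColumnFromRow j r = if j ≤ᵇ r then r ∸ 1 else r

removeColumnFromRow-< : ∀ {j r} → r < j → removeColumnFromRow j r ≡ r
removeColumnFromRow-< {j} {r} r<j = if-¬T (<⇒≱ r<j ∘ ≤ᵇ⇒≤ j r)

removeColumnFromRow-≥ : ∀ {j r} → j ≤ r → removeColumnFromRow j r ≡ r ∸ 1
removeColumnFromRow-≥ j≤r = if-T (≤⇒≤ᵇ j≤r)

removeColumnFromRow-mono : ∀ j {r s} → r ≤ s → removeColumnFromRow j r ≤ removeColumnFromRow j s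
removeColumnFromRow-mono j {r} {s} r≤s with j ≤? r | j ≤? s
... | yes j≤r | _
  rewrite removeColumnFromRow-≥ j≤r | removeColumnFromRow-≥ (≤-trans j≤r r≤s) = ∸-monoˡ-≤ 1 r≤s
... | no j≰r | yes j≤s
  rewrite removeColumnFromRow-< (≰⇒> j≰r) | removeColumnFromRow-≥ j≤s =
  ∸-monoˡ-≤ 1 (<-≤-trans (≰⇒> j≰r) j≤s)
... | no j≰r | no j≰s
  rewrite removeColumnFromRow-< (≰⇒> j≰r) | removeColumnFromRow-< (≰⇒> j≰s) = r≤s

removeColumnFromRows-topRow : ∀ {j s} t → j ≤ suc s →
  map (removeColumnFromRow j) (suc s ∷ t) ≡ s ∷ map (removeColumnFromRow j) t
removeColumnFromRows-topRow t j≤r = ≡.cong (_∷ _) (removeColumnFromRow-≥ j≤r)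

removeColumn-sorted : ∀ j {la} → AllPairs _≥_ la → AllPairs _≥_ (removeColumn j la)
removeColumn-sorted j sorted =
  AllPairsₚ.filter⁺ _ (AllPairsₚ.map⁺ (AllPairs.map (removeColumnFromRow-mono j) sorted))

largestPart≤⇒All≤ : ∀ {la m} → AllPairs _≥_ la → largestPart la ≤ m → All (_≤ m) la
largestPart≤⇒All≤ []        _   = []
largestPart≤⇒All≤ (t≤r ∷ _) r≤m = r≤m ∷ All.map (λ x≤r → ≤-trans x≤r r≤m) t≤r

unoccupied : List ℕ → ℕ → Bool
unoccupied C c = not (any (c ≡ᵇ_) C)

countFree : List ℕ → List ℕ → ℕ
countFree C L = sum (map (indicator ∘ unoccupied C) L)

countFreeAfter : List ℕ → List ℕ → ℕ → ℕ
countFreeAfter C L c₀ = sum (map (λ c → indicator ((c₀ <ᵇ c) ∧ unoccupied C c)) L)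

sum-map-upTo-suc : ∀ (f : ℕ → ℕ) n →
                   sum (map f (upTo (suc n))) ≡ f 0 ℕ.+ sum (map (f ∘ suc) (upTo n))
sum-map-upTo-suc f n =
  ≡.cong (λ xs → f 0 ℕ.+ sum xs) (≡.trans (map-applyUpTo suc f n) (≡.sym (map-upTo (f ∘ suc) n)))

count-upTo : ∀ {x n} → x < n → sum (map (λ c → indicator (c ≡ᵇ x)) (upTo n)) ≡ 1
count-upTo {zero}  {suc n} _ =
  ≡.trans (sum-map-upTo-suc (λ c → indicator (c ≡ᵇ 0)) n)
          (≡.cong suc (≡.trans (sum-map-const 0 (upTo n)) (ℕₚ.*-zeroʳ (length (upTo n)))))
count-upTo {suc x} {suc n} (s≤s x<n) =
  ≡.trans (sum-map-upTo-suc (λ c → indicator (c ≡ᵇ suc x)) n) (count-upTo x<n)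

indicator-not-∨ : ∀ b y → (T b → T (not y)) →
                  indicator (not y) ≡ indicator (not (b ∨ y)) ℕ.+ indicator b
indicator-not-∨ true  true  h = ⊥-elim (h _)
indicator-not-∨ true  false h = ≡.refl
indicator-not-∨ false true  h = ≡.refl
indicator-not-∨ false false h = ≡.refl

countFree-+-length : ∀ {C r} → T (distinct C) → All (_< r) C → countFree C (upTo r) ℕ.+ length C ≡ r
countFree-+-length {[]} {r} _ [] =
  ≡.trans (ℕₚ.+-identityʳ _)
          (≡.trans (sum-map-const 1 (upTo r)) (≡.trans (ℕₚ.*-identityʳ _) (length-upTo r)))
countFree-+-length {x ∷ C} {r} dist (x<r ∷ C<r) = begin
  countFree (x ∷ C) (upTo r) ℕ.+ suc (length C)  ≡⟨ ℕₚ.+-suc _ _ ⟩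
  suc (countFree (x ∷ C) (upTo r)) ℕ.+ length C  ≡⟨ ≡.cong (ℕ._+ length C) removeFreeColumn ⟨
  countFree C (upTo r) ℕ.+ length C              ≡⟨ countFree-+-length distinct-C C<r ⟩
  r                                              ∎
  where
  open ≡.≡-Reasoning
  x∉C = proj₁ (Equivalence.to T-∧ dist)
  distinct-C = proj₂ (Equivalence.to T-∧ dist)
  x∉C-at : ∀ c → T (c ≡ᵇ x) → T (unoccupied C c)
  x∉C-at c c≡x = ≡.subst (T ∘ unoccupied C) (≡.sym (≡ᵇ⇒≡ c x c≡x)) x∉C
  removeFreeColumn : countFree C (upTo r) ≡ suc (countFree (x ∷ C) (upTo r))
  removeFreeColumn = begin
    countFree C (upTo r)
      ≡⟨ ≡.cong sum (map-cong (λ c → indicator-not-∨ (c ≡ᵇ x) (any (c ≡ᵇ_) C) (x∉C-at c)) (upTo r)) ⟩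
    sum (map (λ c → indicator (unoccupied (x ∷ C) c) ℕ.+ indicator (c ≡ᵇ x)) (upTo r))
      ≡⟨ sum-map-+ _ _ (upTo r) ⟩
    countFree (x ∷ C) (upTo r) ℕ.+ sum (map (λ c → indicator (c ≡ᵇ x)) (upTo r))
      ≡⟨ ≡.cong (countFree (x ∷ C) (upTo r) ℕ.+_) (count-upTo x<r) ⟩
    countFree (x ∷ C) (upTo r) ℕ.+ 1
      ≡⟨ ℕₚ.+-comm _ 1 ⟩
    suc (countFree (x ∷ C) (upTo r)) ∎

countFree-upTo : ∀ {C r} → T (distinct C) → All (_< r) C → countFree C (upTo r) ≡ r ∸ length C
countFree-upTo {C} dist C<r =
  ≡.trans (≡.sym (m+n∸n≡m _ (length C))) (≡.cong (_∸ length C) (countFree-+-length dist C<r))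

countFreeAfter-head : ∀ {C x L} → All (x <_) L → countFreeAfter C (x ∷ L) x ≡ countFree C L
countFreeAfter-head {C} {x} {L} x<L =
  ≡.cong₂ ℕ._+_ (≡.cong indicator (∧-¬T _ (<-irrefl ≡.refl ∘ <ᵇ⇒< x x)))
                (≡.cong sum (map-cong-local (All.map (λ x<c → ≡.cong indicator (∧-T _ (<⇒<ᵇ x<c))) x<L)))

countFreeAfter-cons : ∀ {C x L c} → x < c → countFreeAfter C (x ∷ L) c ≡ countFreeAfter C L c
countFreeAfter-cons {x = x} {c = c} x<c =
  ≡.cong (λ b → indicator b ℕ.+ _) (∧-¬T _ (<⇒≱ x<c ∘ <⇒≤ ∘ <ᵇ⇒< c x))

isValid : ℕ → List (Maybe ℕ) → Bool
isValid k p = (length (catMaybes p) ≡ᵇ k) ∧ distinct (catMaybes p)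

isValid⇒countFree : ∀ k p {r} → All (_< r) (catMaybes p) → T (isValid k p) →
                    countFree (catMaybes p) (upTo r) ≡ r ∸ k
isValid⇒countFree k p cols valid with Equivalence.to T-∧ valid
... | length≡k , dist =
  ≡.trans (countFree-upTo dist cols) (≡.cong (_ ∸_) (≡ᵇ⇒≡ (length (catMaybes p)) k length≡k))

allRowAssignments-columns< : ∀ {r la} → All (_≤ r) la →
                             All (λ p → All (_< r) (catMaybes p)) (allRowAssignments la)
allRowAssignments-columns< []           = [] ∷ []
allRowAssignments-columns< {r} {s ∷ la} (s≤r ∷ la≤r) =
  concat⁺ (map⁺ (map⁺ below ∷ map⁺ (All.map rookBelow (all-upTo s))))
  where
  below = allRowAssignments-columns< la≤r
  rookBelow : ∀ {c} → c < s → All (λ p → All (_< r) (catMaybes p)) (map (just c ∷_) (allRowAssignments la))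
  rookBelow c<s = map⁺ (All.map (<-≤-trans c<s s≤r ∷_) below)

module QRookNumbers {ℓ₁ ℓ₂} (R : CommutativeRing ℓ₁ ℓ₂) (q : CommutativeRing.Carrier R) where
  open CommutativeRing R hiding (zero)
  open import Relation.Binary.Reasoning.Setoid setoid
  open import Algebra.Solver.Ring.NaturalCoefficients.Default commutativeSemiring
  open CommutativeSemigroupProperties +-commutativeSemigroup using (interchange)
  open CommutativeSemigroupProperties *-commutativeSemigroup using (x∙yz≈y∙xz)
  open GroupProperties +-group using (x≈z//y)
  open AbelianGroupProperties +-abelianGroup using (⁻¹-anti-homo‿-)
  open RingProperties ring using (x[y-z]≈xy-xz)

  infix 8 q^_
  q^_ : ℕ → Carrier
  q^ n = pow R q n

  [_] : ℕ → Carrier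
  [ n ] = qInt R q n

  ∑ : List Carrier → Carrier
  ∑ = ringSum R

  q^-+ : ∀ m n → q^ (m ℕ.+ n) ≈ q^ m * q^ n
  q^-+ zero    n = sym (*-identityˡ _)
  q^-+ (suc m) n = trans (*-congˡ (q^-+ m n)) (sym (*-assoc q _ _))

  ∑-++ : ∀ xs ys → ∑ (xs ++ ys) ≈ ∑ xs + ∑ ys
  ∑-++ []       ys = sym (+-identityˡ _)
  ∑-++ (x ∷ xs) ys = trans (+-congˡ (∑-++ xs ys)) (sym (+-assoc x _ _))

  module _ {A : Set} where

    ∑-congᴬ : ∀ {f g : A → Carrier} {xs} → All (λ x → f x ≈ g x) xs →
              ∑ (map f xs) ≈ ∑ (map g xs)
    ∑-congᴬ []          = refl
    ∑-congᴬ (fx≈gx ∷ h) = +-cong fx≈gx (∑-congᴬ h)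

    ∑-cong : ∀ {f g : A → Carrier} → (∀ x → f x ≈ g x) → ∀ xs → ∑ (map f xs) ≈ ∑ (map g xs)
    ∑-cong f≈g xs = ∑-congᴬ (All.universal f≈g xs)

    ∑-map-∘ : ∀ {B : Set} (f : B → Carrier) (g : A → B) xs →
              ∑ (map f (map g xs)) ≈ ∑ (map (f ∘ g) xs)
    ∑-map-∘ f g xs = reflexive (≡.cong ∑ (≡.sym (map-∘ xs)))

    ∑-0 : ∀ (xs : List A) → ∑ (map (λ _ → 0#) xs) ≈ 0#
    ∑-0 []       = refl
    ∑-0 (x ∷ xs) = trans (+-identityˡ _) (∑-0 xs)

    ∑-+ : ∀ (f g : A → Carrier) xs →
          ∑ (map (λ x → f x + g x) xs) ≈ ∑ (map f xs) + ∑ (map g xs)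
    ∑-+ f g []       = sym (+-identityʳ 0#)
    ∑-+ f g (x ∷ xs) = trans (+-congˡ (∑-+ f g xs)) (interchange _ _ _ _)

    ∑-*ˡ : ∀ a (f : A → Carrier) xs → ∑ (map (λ x → a * f x) xs) ≈ a * ∑ (map f xs)
    ∑-*ˡ a f []       = sym (zeroʳ a)
    ∑-*ˡ a f (x ∷ xs) = trans (+-congˡ (∑-*ˡ a f xs)) (sym (distribˡ a _ _))

    ∑-*ʳ : ∀ a (f : A → Carrier) xs → ∑ (map (λ x → f x * a) xs) ≈ ∑ (map f xs) * a
    ∑-*ʳ a f []       = sym (zeroˡ a)
    ∑-*ʳ a f (x ∷ xs) = trans (+-congˡ (∑-*ʳ a f xs)) (sym (distribʳ a _ _))

    ∑-filter : ∀ p (f : A → Carrier) xs →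
               ∑ (map f (filterᵇ p xs)) ≈ ∑ (map (λ x → if p x then f x else 0#) xs)
    ∑-filter p f []       = refl
    ∑-filter p f (x ∷ xs) with p x
    ... | true  = +-congˡ (∑-filter p f xs)
    ... | false = trans (∑-filter p f xs) (sym (+-identityˡ _))

  ∑-concatMap : ∀ {A B : Set} (f : A → List B) (g : B → Carrier) xs →
                ∑ (map g (concatMap f xs)) ≈ ∑ (map (λ x → ∑ (map g (f x))) xs)
  ∑-concatMap f g []       = refl
  ∑-concatMap f g (x ∷ xs) =
    trans (reflexive (≡.cong ∑ (map-++ g (f x) (concatMap f xs))))
          (trans (∑-++ (map g (f x)) _) (+-congˡ (∑-concatMap f g xs)))

  ∑-swap : ∀ {A B : Set} (f : A → B → Carrier) xs ys →
           ∑ (map (λ x → ∑ (map (f x) ys)) xs) ≈ ∑ (map (λ y → ∑ (map (λ x → f x y) xs)) ys)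
  ∑-swap f []       ys = sym (∑-0 ys)
  ∑-swap f (x ∷ xs) ys = trans (+-congˡ (∑-swap f xs ys)) (sym (∑-+ (f x) _ ys))

  [1+n]≈1+q[n] : ∀ n → [ suc n ] ≈ 1# + q * [ n ]
  [1+n]≈1+q[n] n = +-congˡ (begin
    ∑ (map q^_ (applyUpTo suc n))          ≡⟨ ≡.cong ∑ (map-applyUpTo suc q^_ n) ⟩
    ∑ (applyUpTo (q^_ ∘ suc) n)            ≡⟨ ≡.cong ∑ (map-upTo (q^_ ∘ suc) n) ⟨
    ∑ (map (λ i → q * q^ i) (upTo n))      ≈⟨ ∑-*ˡ q q^_ (upTo n) ⟩
    q * [ n ]                              ∎)

  [1+n]≈[n]+q^n : ∀ n → [ suc n ] ≈ [ n ] + q^ n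
  [1+n]≈[n]+q^n n = begin
    ∑ (map q^_ (upTo (suc n)))             ≡⟨ ≡.cong (∑ ∘ map q^_) (upTo-∷ʳ n) ⟨
    ∑ (map q^_ (upTo n ∷ʳ n))              ≡⟨ ≡.cong ∑ (map-++ q^_ (upTo n) (n ∷ [])) ⟩
    ∑ (map q^_ (upTo n) ++ q^ n ∷ [])      ≈⟨ ∑-++ (map q^_ (upTo n)) _ ⟩
    [ n ] + (q^ n + 0#)                    ≈⟨ +-congˡ (+-identityʳ _) ⟩
    [ n ] + q^ n                           ∎

  addRow : ℕ → (ℕ → Carrier) → ℕ → Carrier
  addRow r f zero    = q^ r * f 0
  addRow r f (suc k) = q^ (r ∸ suc k) * f (suc k) + [ r ∸ k ] * f k

  -- The first clause matches only the board, so that qRookRec k (r ∷ t) unfolds for a variable k.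
  qRookRec : ℕ → List ℕ → Carrier
  qRookRec k       (r ∷ t) = addRow r (λ j → qRookRec j t) k
  qRookRec zero    []      = 1#
  qRookRec (suc k) []      = 0#

  addRow-cong : ∀ r {f g} → (∀ j → f j ≈ g j) → ∀ k → addRow r f k ≈ addRow r g k
  addRow-cong r f≈g zero    = *-congˡ (f≈g 0)
  addRow-cong r f≈g (suc k) = +-cong (*-congˡ (f≈g (suc k))) (*-congˡ (f≈g k))

  ∑-addRow : ∀ {A : Set} r (f : A → ℕ → Carrier) xs k →
             ∑ (map (λ x → addRow r (f x) k) xs) ≈ addRow r (λ j → ∑ (map (λ x → f x j) xs)) k
  ∑-addRow r f xs zero    = ∑-*ˡ _ _ xs
  ∑-addRow r f xs (suc k) = trans (∑-+ _ _ xs) (+-cong (∑-*ˡ _ _ xs) (∑-*ˡ _ _ xs))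

  qRookRec-vanish : ∀ {m k la} → All (_≤ m) la → m < k → qRookRec k la ≈ 0#
  qRookRec-vanish {k = suc k} []          _         = refl
  qRookRec-vanish {k = suc k} {r ∷ t} (r≤m ∷ t≤m) (s≤s m≤k) = begin
    q^ (r ∸ suc k) * qRookRec (suc k) t + [ r ∸ k ] * qRookRec k t
      ≈⟨ +-cong (*-congˡ (qRookRec-vanish t≤m (s≤s m≤k)))
                (*-congʳ (reflexive (≡.cong [_] (m≤n⇒m∸n≡0 (≤-trans r≤m m≤k))))) ⟩
    q^ (r ∸ suc k) * 0# + 0# * qRookRec k t  ≈⟨ +-cong (zeroʳ _) (zeroˡ _) ⟩
    0# + 0#                                  ≈⟨ +-identityʳ 0# ⟩
    0#                                       ∎

  qRookRec-emptyRow : ∀ k t → qRookRec k (0 ∷ t) ≈ qRookRec k t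
  qRookRec-emptyRow zero    t = *-identityˡ _
  qRookRec-emptyRow (suc k) t =
    trans (+-cong (*-identityˡ _) (trans (*-congʳ (reflexive (≡.cong [_] (0∸n≡0 k)))) (zeroˡ _)))
          (+-identityʳ _)

  qRookRec-nonemptyRows : ∀ k xs → qRookRec k (filterᵇ (1 ≤ᵇ_) xs) ≈ qRookRec k xs
  qRookRec-nonemptyRows k []           = refl
  qRookRec-nonemptyRows k (zero  ∷ xs) = trans (qRookRec-nonemptyRows k xs) (sym (qRookRec-emptyRow k xs))
  qRookRec-nonemptyRows k (suc r ∷ xs) = addRow-cong (suc r) (λ j → qRookRec-nonemptyRows j xs) k

  weight : ℕ → List ℕ → List (Maybe ℕ) → Carrier
  weight k la p = if isValid k p then q^ inv la p else 0#

  qRook≈∑weight : ∀ k la → qRook R q k la ≈ ∑ (map (weight k la) (allRowAssignments la))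
  qRook≈∑weight k la = ∑-filter (isValid k) (λ p → q^ inv la p) (allRowAssignments la)

  ∑-q^countFreeAfter : ∀ C {L} → AllPairs _<_ L →
    ∑ (map (λ c → if unoccupied C c then q^ countFreeAfter C L c else 0#) L) ≈ [ countFree C L ]
  ∑-q^countFreeAfter C {[]}    []         = refl
  ∑-q^countFreeAfter C {x ∷ L} (x<L ∷ L<) = begin
    (if unoccupied C x then q^ countFreeAfter C (x ∷ L) x else 0#) + ∑ (map (g (x ∷ L)) L)
      ≈⟨ +-cong (reflexive (≡.cong (h x) (countFreeAfter-head {C} x<L)))
                (∑-congᴬ (All.map (λ {c} x<c → reflexive (≡.cong (h c) (countFreeAfter-cons {C} {L = L} x<c))) x<L)) ⟩
    (if unoccupied C x then q^ countFree C L else 0#) + ∑ (map (g L) L)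
      ≈⟨ +-congˡ (∑-q^countFreeAfter C L<) ⟩
    (if unoccupied C x then q^ countFree C L else 0#) + [ countFree C L ]
      ≈⟨ addFreeColumn (unoccupied C x) ⟩
    [ countFree C (x ∷ L) ] ∎
    where
    h : ℕ → ℕ → Carrier
    h c n = if unoccupied C c then q^ n else 0#
    g : List ℕ → ℕ → Carrier
    g L c = h c (countFreeAfter C L c)
    addFreeColumn : ∀ b → (if b then q^ countFree C L else 0#) + [ countFree C L ] ≈
                          [ indicator b ℕ.+ countFree C L ]
    addFreeColumn true  = trans (+-comm _ _) (sym ([1+n]≈[n]+q^n (countFree C L)))
    addFreeColumn false = +-identityˡ _

  *-if-congˡ : ∀ b {x y z} → (T b → x ≈ y) → x * (if b then z else 0#) ≈ y * (if b then z else 0#)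
  *-if-congˡ true  x≈y = *-congʳ (x≈y _)
  *-if-congˡ false _   = trans (zeroʳ _) (sym (zeroʳ _))

  module _ {r} (t : List ℕ) (p : List (Maybe ℕ)) (cols : All (_< r) (catMaybes p)) where
    private
      C = catMaybes p

    weight-emptyTopRow : ∀ k → weight k (r ∷ t) (nothing ∷ p) ≈ q^ (r ∸ k) * weight k t p
    weight-emptyTopRow k = trans (factor (isValid k p))
      (*-if-congˡ (isValid k p) (reflexive ∘ ≡.cong q^_ ∘ isValid⇒countFree k p cols))
      where
      factor : ∀ b → (if b then q^ (countFree C (upTo r) ℕ.+ inv t p) else 0#) ≈
                     q^ countFree C (upTo r) * (if b then q^ inv t p else 0#)
      factor true  = q^-+ (countFree C (upTo r)) (inv t p)
      factor false = sym (zeroʳ _)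

    weight-rookInTopRow : ∀ k c → weight (suc k) (r ∷ t) (just c ∷ p) ≈
      (if unoccupied C c then q^ countFreeAfter C (upTo r) c else 0#) * weight k t p
    weight-rookInTopRow k c = factor (length C ≡ᵇ k) (unoccupied C c) (distinct C)
      where
      n = countFreeAfter C (upTo r) c
      factor : ∀ a u d → (if a ∧ (u ∧ d) then q^ (n ℕ.+ inv t p) else 0#) ≈
                         (if u then q^ n else 0#) * (if a ∧ d then q^ inv t p else 0#)
      factor true  true  true  = q^-+ n (inv t p)
      factor true  true  false = sym (zeroʳ _)
      factor true  false d     = sym (zeroˡ _)
      factor false true  d     = sym (zeroʳ _)
      factor false false d     = sym (zeroˡ _)

    ∑-weight-topRow : ∀ k → ∑ (map (λ x → weight k (r ∷ t) (x ∷ p)) (rowChoices r)) ≈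
                            addRow r (λ j → weight j t p) k
    ∑-weight-topRow zero    =
      trans (+-cong (weight-emptyTopRow 0) (trans (∑-map-∘ _ just (upTo r)) (∑-0 (upTo r))))
            (+-identityʳ _)
    ∑-weight-topRow (suc k) = +-cong (weight-emptyTopRow (suc k)) (begin
      ∑ (map (λ x → weight (suc k) (r ∷ t) (x ∷ p)) (map just (upTo r)))
        ≈⟨ ∑-map-∘ _ just (upTo r) ⟩
      ∑ (map (λ c → weight (suc k) (r ∷ t) (just c ∷ p)) (upTo r))
        ≈⟨ ∑-cong (weight-rookInTopRow k) (upTo r) ⟩
      ∑ (map (λ c → (if unoccupied C c then q^ countFreeAfter C (upTo r) c else 0#) * weight k t p) (upTo r))
        ≈⟨ ∑-*ʳ _ _ (upTo r) ⟩
      ∑ (map (λ c → if unoccupied C c then q^ countFreeAfter C (upTo r) c else 0#) (upTo r)) * weight k t p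
        ≈⟨ *-congʳ (∑-q^countFreeAfter C (AllPairsₚ.applyUpTo⁺₁ _ r (λ i<j _ → i<j))) ⟩
      [ countFree C (upTo r) ] * weight k t p
        ≈⟨ *-if-congˡ (isValid k p) (reflexive ∘ ≡.cong [_] ∘ isValid⇒countFree k p cols) ⟩
      [ r ∸ k ] * weight k t p ∎)

  ∑weight≈qRookRec : ∀ {la} → AllPairs _≥_ la → ∀ k →
                     ∑ (map (weight k la) (allRowAssignments la)) ≈ qRookRec k la
  ∑weight≈qRookRec [] zero    = +-identityʳ _
  ∑weight≈qRookRec [] (suc k) = +-identityʳ _
  ∑weight≈qRookRec {r ∷ t} (t≤r ∷ sorted) k = begin
    ∑ (map (weight k (r ∷ t)) (concatMap (λ x → map (x ∷_) P) (rowChoices r)))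
      ≈⟨ ∑-concatMap (λ x → map (x ∷_) P) (weight k (r ∷ t)) (rowChoices r) ⟩
    ∑ (map (λ x → ∑ (map (weight k (r ∷ t)) (map (x ∷_) P))) (rowChoices r))
      ≈⟨ ∑-cong (λ x → ∑-map-∘ (weight k (r ∷ t)) (x ∷_) P) (rowChoices r) ⟩
    ∑ (map (λ x → ∑ (map (λ p → weight k (r ∷ t) (x ∷ p)) P)) (rowChoices r))
      ≈⟨ ∑-swap (λ x p → weight k (r ∷ t) (x ∷ p)) (rowChoices r) P ⟩
    ∑ (map (λ p → ∑ (map (λ x → weight k (r ∷ t) (x ∷ p)) (rowChoices r))) P)
      ≈⟨ ∑-congᴬ (All.map (λ {p} cols → ∑-weight-topRow t p cols k) (allRowAssignments-columns< t≤r)) ⟩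
    ∑ (map (λ p → addRow r (λ j → weight j t p) k) P)
      ≈⟨ ∑-addRow r (λ p j → weight j t p) P k ⟩
    addRow r (λ j → ∑ (map (weight j t) P)) k
      ≈⟨ addRow-cong r (λ j → ∑weight≈qRookRec sorted j) k ⟩
    qRookRec k (r ∷ t) ∎
    where P = allRowAssignments t

  qRook≈qRookRec : ∀ {la} → AllPairs _≥_ la → ∀ k → qRook R q k la ≈ qRookRec k la
  qRook≈qRookRec {la} sorted k = trans (qRook≈∑weight k la) (∑weight≈qRookRec sorted k)

  qRook-removeColumn : ∀ {la} → AllPairs _≥_ la → ∀ j k →
    qRook R q k (removeColumn j la) ≈ qRookRec k (map (removeColumnFromRow j) la)
  qRook-removeColumn {la} sorted j k =
    trans (qRook≈qRookRec (removeColumn-sorted j sorted) k)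
          (qRookRec-nonemptyRows k (map (removeColumnFromRow j) la))

  hornerSum : (ℕ → Carrier) → ℕ → Carrier
  hornerSum F zero    = 0#
  hornerSum F (suc m) = q * hornerSum F m + F (suc m)

  hornerSum-cong : ∀ {F G} m → (∀ {j} → j ≤ m → F j ≈ G j) → hornerSum F m ≈ hornerSum G m
  hornerSum-cong zero    F≈G = refl
  hornerSum-cong (suc m) F≈G = +-cong (*-congˡ (hornerSum-cong m (F≈G ∘ m≤n⇒m≤1+n))) (F≈G ≤-refl)

  hornerSum-+ : ∀ F G m → hornerSum (λ j → F j + G j) m ≈ hornerSum F m + hornerSum G m
  hornerSum-+ F G zero    = sym (+-identityʳ 0#)
  hornerSum-+ F G (suc m) = begin
    q * hornerSum (λ j → F j + G j) m + (F (suc m) + G (suc m))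
      ≈⟨ +-congʳ (trans (*-congˡ (hornerSum-+ F G m)) (distribˡ q _ _)) ⟩
    (q * hornerSum F m + q * hornerSum G m) + (F (suc m) + G (suc m))
      ≈⟨ interchange _ _ _ _ ⟩
    hornerSum F (suc m) + hornerSum G (suc m) ∎

  hornerSum-*ˡ : ∀ a F m → hornerSum (λ j → a * F j) m ≈ a * hornerSum F m
  hornerSum-*ˡ a F zero    = sym (zeroʳ a)
  hornerSum-*ˡ a F (suc m) = begin
    q * hornerSum (λ j → a * F j) m + a * F (suc m) ≈⟨ +-congʳ (*-congˡ (hornerSum-*ˡ a F m)) ⟩
    q * (a * hornerSum F m) + a * F (suc m)         ≈⟨ +-congʳ (x∙yz≈y∙xz q a _) ⟩
    a * (q * hornerSum F m) + a * F (suc m)         ≈⟨ distribˡ a _ _ ⟨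
    a * hornerSum F (suc m)                         ∎

  ∑≈hornerSum : ∀ m F → ∑ (map (λ j → q^ (m ∸ j) * F j) (map suc (upTo m))) ≈ hornerSum F m
  ∑≈hornerSum zero    F = refl
  ∑≈hornerSum (suc m) F = begin
    ∑ (map G (map suc (upTo (suc m))))
      ≡⟨ ≡.cong (∑ ∘ map G ∘ map suc) (upTo-∷ʳ m) ⟨
    ∑ (map G (map suc (upTo m ∷ʳ m)))
      ≡⟨ ≡.cong (∑ ∘ map G) (map-++ suc (upTo m) (m ∷ [])) ⟩
    ∑ (map G (map suc (upTo m) ++ suc m ∷ []))
      ≡⟨ ≡.cong ∑ (map-++ G (map suc (upTo m)) (suc m ∷ [])) ⟩
    ∑ (map G (map suc (upTo m)) ++ G (suc m) ∷ [])
      ≈⟨ ∑-++ (map G (map suc (upTo m))) _ ⟩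
    ∑ (map G (map suc (upTo m))) + (G (suc m) + 0#)
      ≈⟨ +-cong (∑-congᴬ (map⁺ (All.map oneColumnFurther (all-upTo m)))) (+-identityʳ _) ⟩
    ∑ (map (λ j → q * (q^ (m ∸ j) * F j)) (map suc (upTo m))) + G (suc m)
      ≈⟨ +-cong (∑-*ˡ q _ (map suc (upTo m))) lastColumn ⟩
    q * ∑ (map (λ j → q^ (m ∸ j) * F j) (map suc (upTo m))) + F (suc m)
      ≈⟨ +-congʳ (*-congˡ (∑≈hornerSum m F)) ⟩
    hornerSum F (suc m) ∎
    where
    G : ℕ → Carrier
    G j = q^ (suc m ∸ j) * F j
    oneColumnFurther : ∀ {j} → j < m → G (suc j) ≈ q * (q^ (m ∸ suc j) * F (suc j))
    oneColumnFurther j<m = trans (*-congʳ (reflexive (≡.cong q^_ (+-∸-assoc 1 j<m)))) (*-assoc q _ _)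
    lastColumn : G (suc m) ≈ F (suc m)
    lastColumn = trans (*-congʳ (reflexive (≡.cong q^_ (n∸n≡0 m)))) (*-identityˡ _)

  -- The identity of the theorem with its subtracted term moved to the left, so that every step is
  -- semiring reasoning.
  ColumnIdentity : List ℕ → ℕ → ℕ → Set ℓ₂
  ColumnIdentity la m i =
    hornerSum (λ j → qRookRec i (map (removeColumnFromRow j) la)) m + qRookRec (suc i) la * q^ m
      ≈ qRookRec i la * [ m ∸ i ] + qRookRec (suc i) la * q^ (m ∸ i ∸ 1)

  columnIdentity-zero : ∀ la i → ColumnIdentity la 0 i
  columnIdentity-zero la i rewrite 0∸n≡0 i = +-congʳ (sym (zeroʳ _))

  -- For m ≤ i the truncated subtractions break the pattern of the case i < m; there A = R_{i+1}
  -- vanishes, and for m < i so does B = R_i.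
  columnIdentity-rhs-suc : ∀ m i {A B} → (m ≤ i → A ≈ 0#) → (m < i → B ≈ 0#) →
    q * (B * [ m ∸ i ] + A * q^ (m ∸ i ∸ 1)) + B ≈ B * [ suc m ∸ i ] + A * q^ (suc m ∸ i ∸ 1)
  columnIdentity-rhs-suc zero    zero    {A} {B} A≈0 _ = begin
    q * (B * 0# + A * 1#) + B      ≈⟨ +-congʳ (*-congˡ (+-congˡ (*-congʳ (A≈0 z≤n)))) ⟩
    q * (B * 0# + 0# * 1#) + B
      ≈⟨ solve 2 (λ q B → q :* (B :* con 0 :+ con 0 :* con 1) :+ B := B :* (con 1 :+ con 0) :+ con 0 :* con 1)
                 refl q B ⟩
    B * (1# + 0#) + 0# * 1#        ≈⟨ +-congˡ (*-congʳ (A≈0 z≤n)) ⟨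
    B * (1# + 0#) + A * 1#         ∎
  columnIdentity-rhs-suc zero    (suc i) {A} {B} A≈0 B≈0 rewrite 0∸n≡0 i = begin
    q * (B * 0# + A * 1#) + B      ≈⟨ +-cong (*-congˡ (+-cong (zeroʳ B) (*-congʳ (A≈0 z≤n)))) (B≈0 (s≤s z≤n)) ⟩
    q * (0# + 0# * 1#) + 0#
      ≈⟨ solve 1 (λ q → q :* (con 0 :+ con 0 :* con 1) :+ con 0 := con 0 :+ con 0 :* con 1) refl q ⟩
    0# + 0# * 1#                   ≈⟨ +-cong (zeroʳ B) (*-congʳ (A≈0 z≤n)) ⟨
    B * 0# + A * 1#                ∎
  columnIdentity-rhs-suc (suc m) zero    {A} {B} _ _ = begin
    q * (B * [ suc m ] + A * q^ m) + B
      ≈⟨ solve 5 (λ q B I A P → q :* (B :* I :+ A :* P) :+ B := B :* (con 1 :+ q :* I) :+ A :* (q :* P))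
                 refl q B [ suc m ] A (q^ m) ⟩
    B * (1# + q * [ suc m ]) + A * (q * q^ m)      ≈⟨ +-congʳ (*-congˡ ([1+n]≈1+q[n] (suc m))) ⟨
    B * [ suc (suc m) ] + A * q^ (suc m)           ∎
  columnIdentity-rhs-suc (suc m) (suc i) A≈0 B≈0 = columnIdentity-rhs-suc m i (A≈0 ∘ s≤s) (B≈0 ∘ s≤s)

  columnIdentity-suc : ∀ {la} m i → All (_≤ m) la → ColumnIdentity la m i → ColumnIdentity la (suc m) i
  columnIdentity-suc {la} m i la≤m hyp = begin
    (q * H + F (suc m)) + A * (q * q^ m)
      ≈⟨ +-congʳ (+-congˡ (reflexive (≡.cong (qRookRec i) lastColumnAbsent))) ⟩
    (q * H + B) + A * (q * q^ m)
      ≈⟨ solve 5 (λ q H B A P → (q :* H :+ B) :+ A :* (q :* P) := q :* (H :+ A :* P) :+ B)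
                 refl q H B A (q^ m) ⟩
    q * (H + A * q^ m) + B
      ≈⟨ +-congʳ (*-congˡ hyp) ⟩
    q * (B * [ m ∸ i ] + A * q^ (m ∸ i ∸ 1)) + B
      ≈⟨ columnIdentity-rhs-suc m i (qRookRec-vanish la≤m ∘ s≤s) (qRookRec-vanish la≤m) ⟩
    B * [ suc m ∸ i ] + A * q^ (suc m ∸ i ∸ 1) ∎
    where
    F = λ j → qRookRec i (map (removeColumnFromRow j) la)
    H = hornerSum F m
    A = qRookRec (suc i) la
    B = qRookRec i la
    lastColumnAbsent : map (removeColumnFromRow (suc m)) la ≡ la
    lastColumnAbsent = map-id-local (All.map (removeColumnFromRow-< ∘ s≤s) la≤m)

  columnIdentity-≤′ : ∀ {la m n} i → All (_≤ m) la → ColumnIdentity la m i → m ≤′ n →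
                      ColumnIdentity la n i
  columnIdentity-≤′ i la≤m hyp (≤′-reflexive ≡.refl) = hyp
  columnIdentity-≤′ {n = suc n} i la≤m hyp (≤′-step m≤′n) =
    columnIdentity-suc n i (All.map (λ r≤m → ≤-trans r≤m (≤′⇒≤ m≤′n)) la≤m)
                           (columnIdentity-≤′ i la≤m hyp m≤′n)

  module TopRow (s : ℕ) (t : List ℕ) where
    X : ℕ → List ℕ
    X j = map (removeColumnFromRow j) t

    H : ℕ → Carrier
    H i = hornerSum (λ j → qRookRec i (X j)) (suc s)

    Q : Carrier
    Q = q^ (suc s)

    hornerSum-topRow : ∀ i → hornerSum (λ j → qRookRec i (map (removeColumnFromRow j) (suc s ∷ t))) (suc s)
                               ≈ hornerSum (λ j → qRookRec i (s ∷ X j)) (suc s)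
    hornerSum-topRow i =
      hornerSum-cong (suc s) (reflexive ∘ ≡.cong (qRookRec i) ∘ removeColumnFromRows-topRow t)

  columnIdentity-topRow : ∀ {r t} → All (_≤ r) t → (∀ i → ColumnIdentity t r i) →
                          ∀ i → ColumnIdentity (r ∷ t) r i
  columnIdentity-topRow {zero}  {t} _ _   i       = columnIdentity-zero (0 ∷ t) i
  columnIdentity-topRow {suc s} {t} _ hyp zero    = begin
    hornerSum (λ j → qRookRec 0 (map (removeColumnFromRow j) (suc s ∷ t))) (suc s)
      + (q^ s * C₁ + [ suc s ] * C₀) * Q
      ≈⟨ +-congʳ (trans (hornerSum-topRow 0) (hornerSum-*ˡ (q^ s) _ (suc s))) ⟩
    q^ s * H₀ + (q^ s * C₁ + [ suc s ] * C₀) * Q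
      ≈⟨ solve 6 (λ P I H₀ C₀ C₁ Q → P :* H₀ :+ (P :* C₁ :+ I :* C₀) :* Q
                                     := P :* (H₀ :+ C₁ :* Q) :+ I :* (C₀ :* Q))
                 refl (q^ s) [ suc s ] H₀ C₀ C₁ Q ⟩
    q^ s * (H₀ + C₁ * Q) + [ suc s ] * (C₀ * Q)
      ≈⟨ +-congʳ (*-congˡ (hyp 0)) ⟩
    q^ s * (C₀ * [ suc s ] + C₁ * q^ s) + [ suc s ] * (C₀ * Q)
      ≈⟨ solve 5 (λ P I C₀ C₁ Q → P :* (C₀ :* I :+ C₁ :* P) :+ I :* (C₀ :* Q)
                                  := (Q :* C₀) :* I :+ (P :* C₁ :+ I :* C₀) :* P)
                 refl (q^ s) [ suc s ] C₀ C₁ Q ⟩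
    (Q * C₀) * [ suc s ] + (q^ s * C₁ + [ suc s ] * C₀) * q^ s ∎
    where
    open TopRow s t
    H₀ = H 0
    C₀ = qRookRec 0 t
    C₁ = qRookRec 1 t
  columnIdentity-topRow {suc s} {t} _ hyp (suc k) = begin
    hornerSum (λ j → qRookRec (suc k) (map (removeColumnFromRow j) (suc s ∷ t))) (suc s) + A * Q
      ≈⟨ +-congʳ (begin
           hornerSum (λ j → qRookRec (suc k) (map (removeColumnFromRow j) (suc s ∷ t))) (suc s)
             ≈⟨ hornerSum-topRow (suc k) ⟩
           hornerSum (λ j → q^ a * qRookRec (suc k) (X j) + [ b ] * qRookRec k (X j)) (suc s)
             ≈⟨ hornerSum-+ _ _ (suc s) ⟩
           hornerSum (λ j → q^ a * qRookRec (suc k) (X j)) (suc s)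
             + hornerSum (λ j → [ b ] * qRookRec k (X j)) (suc s)
             ≈⟨ +-cong (hornerSum-*ˡ (q^ a) _ (suc s)) (hornerSum-*ˡ [ b ] _ (suc s)) ⟩
           q^ a * H₁ + [ b ] * H₀ ∎) ⟩
    (q^ a * H₁ + [ b ] * H₀) + (q^ a * C₂ + [ b ] * C₁) * Q
      ≈⟨ solve 7 (λ P I H₁ H₀ C₁ C₂ Q → (P :* H₁ :+ I :* H₀) :+ (P :* C₂ :+ I :* C₁) :* Q
                                        := P :* (H₁ :+ C₂ :* Q) :+ I :* (H₀ :+ C₁ :* Q))
                 refl (q^ a) [ b ] H₁ H₀ C₁ C₂ Q ⟩
    q^ a * (H₁ + C₂ * Q) + [ b ] * (H₀ + C₁ * Q)
      ≈⟨ +-cong (*-congˡ hyp₁) (*-congˡ hyp₀) ⟩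
    q^ a * (C₁ * [ b ] + C₂ * q^ a) + [ b ] * (C₀ * [ c ] + C₁ * q^ b)
      ≈⟨ solve 7 (λ P P′ I I′ C₀ C₁ C₂ → P :* (C₁ :* I :+ C₂ :* P) :+ I :* (C₀ :* I′ :+ C₁ :* P′)
                                         := (P′ :* C₁ :+ I′ :* C₀) :* I :+ (P :* C₂ :+ I :* C₁) :* P)
                 refl (q^ a) (q^ b) [ b ] [ c ] C₀ C₁ C₂ ⟩
    B * [ b ] + A * q^ a
      ≡⟨ ≡.cong (λ n → B * [ b ] + A * q^ n) (m∸n∸1≡m∸[1+n] s k) ⟨
    B * [ b ] + A * q^ (b ∸ 1) ∎
    where
    open TopRow s t
    a = s ∸ suc k
    b = s ∸ k
    c = suc s ∸ k
    H₀ = H k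
    H₁ = H (suc k)
    C₀ = qRookRec k t
    C₁ = qRookRec (suc k) t
    C₂ = qRookRec (suc (suc k)) t
    A = qRookRec (suc (suc k)) (suc s ∷ t)
    B = qRookRec (suc k) (suc s ∷ t)
    hyp₁ : H₁ + C₂ * Q ≈ C₁ * [ b ] + C₂ * q^ a
    hyp₁ = trans (hyp (suc k)) (+-congˡ (*-congˡ (reflexive (≡.cong q^_ (m∸n∸1≡m∸[1+n] s k)))))
    hyp₀ : H₀ + C₁ * Q ≈ C₀ * [ c ] + C₁ * q^ b
    hyp₀ = trans (hyp k) (+-congˡ (*-congˡ (reflexive (≡.cong q^_ (m∸n∸1≡m∸[1+n] (suc s) k)))))

  columnIdentity : ∀ {la m} → AllPairs _≥_ la → All (_≤ m) la → ∀ i → ColumnIdentity la m i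
  columnIdentity {m = m} [] [] i =
    columnIdentity-≤′ {n = m} i [] (columnIdentity-zero [] i) (≤⇒≤′ z≤n)
  columnIdentity (t≤r ∷ sorted) (r≤m ∷ _) i =
    columnIdentity-≤′ i (≤-refl ∷ t≤r) (columnIdentity-topRow t≤r (columnIdentity sorted t≤r) i)
                        (≤⇒≤′ r≤m)

  x+yz≈u+yw⇒x≈u-y[z-w] : ∀ {x y z u w} → x + y * z ≈ u + y * w → x ≈ u - y * (z - w)
  x+yz≈u+yw⇒x≈u-y[z-w] {x} {y} {z} {u} {w} eq = begin
    x                    ≈⟨ x≈z//y x (y * z) (u + y * w) eq ⟩
    (u + y * w) - y * z  ≈⟨ +-assoc u (y * w) (- (y * z)) ⟩
    u + (y * w - y * z)  ≈⟨ +-congˡ (⁻¹-anti-homo‿- (y * z) (y * w)) ⟨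
    u - (y * z - y * w)  ≈⟨ +-congˡ (-‿cong (x[y-z]≈xy-xz y z w)) ⟨
    u - y * (z - w)      ∎

lemma3p3 : ∀ {c ℓ} (R : CommutativeRing c ℓ) (q : CommutativeRing.Carrier R)
           (la : List ℕ) → IsPartition la → (m : ℕ) → largestPart la ≤ m → (i : ℕ) →
           let open CommutativeRing R in
           ringSum R (map (λ j → pow R q (m ∸ j) * qRook R q i (removeColumn j la)) (map suc (upTo m)))
             ≈ (qRook R q i la * qInt R q (m ∸ i)
                - qRook R q (suc i) la * (pow R q m - pow R q (m ∸ i ∸ 1)))
lemma3p3 R q la (decreasing , _) m la₁≤m i = begin
  ∑ (map (λ j → q^ (m ∸ j) * qRook R q i (removeColumn j la)) (map suc (upTo m)))
    ≈⟨ ∑-cong (λ j → *-congˡ (qRook-removeColumn sorted j i)) (map suc (upTo m)) ⟩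
  ∑ (map (λ j → q^ (m ∸ j) * qRookRec i (map (removeColumnFromRow j) la)) (map suc (upTo m)))
    ≈⟨ ∑≈hornerSum m _ ⟩
  hornerSum (λ j → qRookRec i (map (removeColumnFromRow j) la)) m
    ≈⟨ x+yz≈u+yw⇒x≈u-y[z-w] (columnIdentity sorted (largestPart≤⇒All≤ sorted la₁≤m) i) ⟩
  qRookRec i la * [ m ∸ i ] - qRookRec (suc i) la * (q^ m - q^ (m ∸ i ∸ 1))
    ≈⟨ +-cong (*-congʳ (qRook≈qRookRec sorted i))
              (-‿cong (*-congʳ (qRook≈qRookRec sorted (suc i)))) ⟨
  qRook R q i la * [ m ∸ i ] - qRook R q (suc i) la * (q^ m - q^ (m ∸ i ∸ 1)) ∎
  where
  open CommutativeRing R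
  open QRookNumbers R q
  open import Relation.Binary.Reasoning.Setoid setoid
  sorted : AllPairs _≥_ la
  sorted = Linked⇒AllPairs (λ y≤x z≤y → ≤-trans z≤y y≤x) decreasing
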